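{- Let $G$ be a weighted game arena with partial observation and $\ell_{\max}\in\mathbb{N}_0$. If Eve has a winning observation-based strategy in $G$ for the objective $\mathsf{DirFix}(\ell_{\max})$, then Eve wins the safety game on $G'$ (avoiding $\mathcal{U}$).
   Context: A WGA is $G=\langle Q,q_I,\Sigma,\Delta,w,Obs\rangle$: $Q$ finite set of states, $q_I\in Q$, $\Sigma$ finite set of actions, $\Delta\subseteq Q\times\Sigma\times Q$ total transition relation, $w:\Delta\to\mathbb{Z}$, $Obs$ a partition of $Q$ with $\{q_I\}\in Obs$; $W=\max\{|w(t)|:t\in\Delta\}$; $\mathrm{post}_\sigma(s)=\{q':\exists q\in s,(q,\sigma,q')\in\Delta\}$. Concrete paths are sequences $q_0\sigma_0q_1\dots$ with $(q_i,\sigma_i,q_{i+1})\in\Delta$; abstract paths are sequences $o_0\sigma_0o_1\dots$ of observations and actions realized by some concrete path with $q_i\in o_i$; $\gamma(\psi)$ is the set of concrete paths with the same actions and $q_i\in o_i$. For concrete $\chi$, $w(\chi[k..l])=\sum_{i=k}^{l-1}w(q_i,\sigma_i,q_{i+1})$. A play is an infinite abstract path starting with $\{q_I\}$. An observation-based strategy for Eve maps finite play prefixes $o_0\sigma_0\dots o_n$ to actions; consistency and winning are as usual (all consistent plays lie in the objective). $\mathbb{N}_0=\{1,2,\dots\}$. For concrete $\chi$, $i\ge0$, $\ell\in\mathbb{N}_0$: $\chi\in\mathsf{GW}(i,\ell)$ iff some $1\le j\le\ell$ has $w(\chi[i..i+j])\ge0$; $\mathsf{DirFix}(\ell)$ is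 the set of plays $\psi$ with $\pi\in\mathsf{GW}(i,\ell)$ for all $\pi\in\gamma(\psi)$ and $i\ge0$. Construction of $G'$: $\mathcal{F}$ is the set of all functions $f:Q\to(\{1,\dots,\ell_{\max}\}\to\{ -W\ell_{\max},\dots,0\})\cup\{\bot\}$; $\mathrm{supp}(f)=\{q:f(q)\ne\bot\}$, $f(q)_i=f(q)(i)$. $f_I(q_I)_i=0$ for all $i$ and $f_I(q)=\bot$ for $q\ne q_I$. For $\sigma\in\Sigma$, $f_2$ is a $\sigma$-successor of $f_1$ if $\mathrm{supp}(f_2)=\mathrm{post}_\sigma(\mathrm{supp}(f_1))\cap o$ for some $o\in Obs$ and for all $q\in\mathrm{supp}(f_2)$, $1\le j\le\ell_{\max}$: $f_2(q)_j=\max\{ -W\ell_{\max},\min\{0,\zeta_j(q)\}\}$ with $\zeta_1(q)=\min\{w(p,\sigma,q):p\in\mathrm{supp}(f_1),(p,\sigma,q)\in\Delta\}$ and, for $j\ge2$, $\zeta_j(q)=\min\{f_1(p)_{j-1}+w(p,\sigma,q):p\in\mathrm{supp}(f_1),(p,\sigma,q)\in\Delta,f_1(p)_{j-1}<0\}$ ($\min\emptyset=+\infty$). $G'$ is the perfect-information game arena with positions $\mathcal{F}$, initial position $f_I$, and transitions $(f_1,\sigma,f_2)$ whenever $f_2$ is a $\sigma$-successor of $f_1$: in each round Eve picks $\sigma$ (as a function of the full history $f_0\sigma_0\dots f_n$) and Adam picks any $\sigma$-successor. Let $\mathcal{U}=\{f\in\mathcal{F}:\exists q\in\mathrm{supp}(f),f(q)_{\ell_{\max}}<0\}$.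 Eve wins the safety game on $G'$ if she has a strategy such that every consistent play from $f_I$ never visits $\mathcal{U}$. -}

module Defs where

open import Function using (_∘_)
open import Data.Nat as ℕ using (ℕ; zero; suc; _⊔_)
open import Data.Integer as ℤ using (ℤ; +_; -_; ∣_∣; _⊓_)
open import Data.Fin as Fin using (Fin; zero; suc; inject₁; fromℕ)
open import Data.Bool using (Bool; true; false; if_then_else_)
open import Data.Maybe using (Maybe; just; nothing; Is-just)
open import Data.Product using (Σ; ∃; ∃₂; _×_; _,_)
open import Data.List using (List; []; _∷_; _++_; [_])
open import Relation.Nullary using (¬_; yes; no)
open import Relation.Nullary.Decidable using (⌊_⌋)
open import Relation.Binary.PropositionalEquality using (_≡_)

-- The partition Obs is
-- given by a labelling obs : Q → Fin nO; the blocks of Obs are the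
-- nonempty fibres {q | obs q ≡ o}.  obs-qI says {qI} is a block.

record WGA : Set where
  field
    nQ nA nO : ℕ
    qI       : Fin nQ
    Δ        : Fin nQ → Fin nA → Fin nQ → Bool
    Δ-total  : ∀ q σ → ∃ λ q' → Δ q σ q' ≡ true
    w        : Fin nQ → Fin nA → Fin nQ → ℤ
    obs      : Fin nQ → Fin nO
    obs-qI   : ∀ q → obs q ≡ obs qI → q ≡ qI

finMaxℕ : (n : ℕ) → (Fin n → ℕ) → ℕ
finMaxℕ zero    f = 0
finMaxℕ (suc n) f = f zero ⊔ finMaxℕ n (f ∘ suc)

-- nothing plays the role of +∞
minM : Maybe ℤ → Maybe ℤ → Maybe ℤ
minM nothing  y        = y
minM (just x) nothing  = just x
minM (just x) (just y) = just (x ⊓ y)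

finMinM : (n : ℕ) → (Fin n → Maybe ℤ) → Maybe ℤ
finMinM zero    f = nothing
finMinM (suc n) f = minM (f zero) (finMinM n (f ∘ suc))

min0 : Maybe ℤ → ℤ
min0 nothing  = + 0
min0 (just x) = + 0 ⊓ x

prefix : {A B : Set} → (ℕ → A) → (ℕ → B) → ℕ → List (A × B)
prefix X Y zero    = []
prefix X Y (suc i) = prefix X Y i ++ [ (X i , Y i) ]

module _ (G : WGA) where
  open WGA G

  maxW : ℕ
  maxW = finMaxℕ nQ λ p → finMaxℕ nA λ σ → finMaxℕ nQ λ q →
           if Δ p σ q then ∣ w p σ q ∣ else 0

  -- The game G with partial observation.
  -- An (infinite) abstract path is given by observations o : ℕ → Fin nO
  -- and actions a : ℕ → Fin nA, i.e. o 0, a 0, o 1, a 1, ...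

  InGamma : (ℕ → Fin nO) → (ℕ → Fin nA) → (ℕ → Fin nQ) → Set
  InGamma o a q = ∀ i → (obs (q i) ≡ o i) × (Δ (q i) (a i) (q (suc i)) ≡ true)

  IsPlay : (ℕ → Fin nO) → (ℕ → Fin nA) → Set
  IsPlay o a = (o 0 ≡ obs qI) × ∃ λ q → InGamma o a q

  segW : (ℕ → Fin nQ) → (ℕ → Fin nA) → ℕ → ℕ → ℤ
  segW q a i zero    = + 0
  segW q a i (suc j) = w (q i) (a i) (q (suc i)) ℤ.+ segW q a (suc i) j

  GW : (ℕ → Fin nQ) → (ℕ → Fin nA) → ℕ → ℕ → Set
  GW q a i ℓ = ∃ λ j → (1 ℕ.≤ j) × (j ℕ.≤ ℓ) × (+ 0 ℤ.≤ segW q a i j)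

  DirFix : ℕ → (ℕ → Fin nO) → (ℕ → Fin nA) → Set
  DirFix ℓ o a = ∀ q → InGamma o a q → ∀ i → GW q a i ℓ

  ObsStrategy : Set
  ObsStrategy = List (Fin nO × Fin nA) → Fin nO → Fin nA

  ConsistentObs : ObsStrategy → (ℕ → Fin nO) → (ℕ → Fin nA) → Set
  ConsistentObs s o a = ∀ i → a i ≡ s (prefix o a i) (o i)

  EveWinsDirFix : ℕ → Set
  EveWinsDirFix ℓ = ∃ λ (s : ObsStrategy) →
    ∀ o a → IsPlay o a → ConsistentObs s o a → DirFix ℓ o a

  -- The perfect-information game G' for ℓmax = suc L.
  -- f q = nothing means f(q) = ⊥; otherwise f q = just v with
  -- v : Fin (suc L) → ℤ, where index i stands for j = toℕ i + 1.

  module _ (L : ℕ) where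

    Pos : Set
    Pos = Fin nQ → Maybe (Fin (suc L) → ℤ)

    fI : Pos
    fI q with q Fin.≟ qI
    ... | yes _ = just (λ _ → + 0)
    ... | no  _ = nothing

    ζ : Pos → Fin nA → Fin nQ → Fin (suc L) → Maybe ℤ
    ζ f σ q zero = finMinM nQ λ p → step (f p) p
      where
      step : Maybe (Fin (suc L) → ℤ) → Fin nQ → Maybe ℤ
      step nothing  p = nothing
      step (just v) p = if Δ p σ q then just (w p σ q) else nothing
    ζ f σ q (suc i) = finMinM nQ λ p → step (f p) p
      where
      step : Maybe (Fin (suc L) → ℤ) → Fin nQ → Maybe ℤ
      step nothing  p = nothing
      step (just v) p =
        if Δ p σ q ∧' ⌊ v (inject₁ i) ℤ.<? + 0 ⌋
        then just (v (inject₁ i) ℤ.+ w p σ q) else nothing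
        where
        _∧'_ : Bool → Bool → Bool
        true  ∧' b = b
        false ∧' b = false

    clamp : Maybe ℤ → ℤ
    clamp z = (- (+ (maxW ℕ.* suc L))) ℤ.⊔ min0 z

    InPost : Pos → Fin nA → Fin nQ → Set
    InPost f σ q = ∃ λ p → Is-just (f p) × (Δ p σ q ≡ true)

    IsSucc : Pos → Fin nA → Pos → Set
    IsSucc f₁ σ f₂ = ∃ λ (o : Fin nO) → (∃ λ q → obs q ≡ o)
      × (∀ q → Is-just (f₂ q) → InPost f₁ σ q × (obs q ≡ o))
      × (∀ q → InPost f₁ σ q → obs q ≡ o → Is-just (f₂ q))
      × (∀ q v → f₂ q ≡ just v → ∀ j → v j ≡ clamp (ζ f₁ σ q j))

    BadPos : Pos → Set
    BadPos f = ∃₂ λ q v → (f q ≡ just v) × (v (fromℕ L) ℤ.< + 0)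

    PIStrategy : Set
    PIStrategy = List (Pos × Fin nA) → Pos → Fin nA

    ConsistentPI : PIStrategy → (ℕ → Pos) → (ℕ → Fin nA) → Set
    ConsistentPI s F A = (F 0 ≡ fI)
      × (∀ i → (A i ≡ s (prefix F A i) (F i)) × IsSucc (F i) (A i) (F (suc i)))

    EveWinsSafety : Set
    EveWinsSafety = ∃ λ (s : PIStrategy) →
      ∀ F A → ConsistentPI s F A → ∀ i → ¬ BadPos (F i)

-- Eve plays in G' by reading off the observation block containing the support of the
-- current position and answering with her winning strategy in G.  Along any resulting
-- play, an entry f(q)_j < 0 of the position reached after n rounds is witnessed by a
-- concrete path of G, consistent with the observations and actions so far and ending
-- in q, on which every segment starting at step n − j and ending by step n has negative
-- weight, the longest one weighing at most f(q)_j.  A position in U thus yields a finite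
-- history consistent with Eve's strategy in which no window of length ≤ ℓmax from some
-- start is good; continuing it by that strategy gives a consistent play outside
-- DirFix(ℓmax).

module Submission where

open import Defs
open import Data.Nat using (ℕ; suc)

open import Function using (_∘_)
open import Data.Nat as ℕ using (zero; _+_; _≤_; _<_; _<?_; _≤?_; z≤n; s≤s)
import Data.Nat.Properties as ℕP
open import Data.Integer as ℤ using (ℤ; +_)
import Data.Integer.Properties as ℤP
open import Data.Fin as Fin using (Fin; zero; suc; inject₁; fromℕ; toℕ)
import Data.Fin.Properties as FinP
open import Data.Bool using (true; false)
open import Data.Unit using (tt)
open import Data.Maybe using (Maybe; just; nothing; Is-just)
open import Data.Maybe.Relation.Unary.Any using () renaming (just to is-just)
open import Data.Product as Prod using (∃; _×_; _,_; proj₁; proj₂)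
open import Data.Sum using (_⊎_; inj₁; inj₂)
open import Data.List using (List; []; _++_; [_]; map)
import Data.List.Properties as ListP
open import Data.Empty using (⊥-elim)
open import Relation.Nullary using (¬_; yes; no; contradiction)
open import Relation.Binary.PropositionalEquality
  using (_≡_; refl; sym; trans; cong; cong₂; subst; subst₂; module ≡-Reasoning)

Is-just⇒≡just : ∀ {X : Set} {m : Maybe X} → Is-just m → ∃ λ x → m ≡ just x
Is-just⇒≡just (is-just {x = x} _) = x , refl

≡just⇒Is-just : ∀ {X : Set} {m : Maybe X} {x : X} → m ≡ just x → Is-just m
≡just⇒Is-just refl = is-just tt

minM-sel : ∀ a b {x} → minM a b ≡ just x → a ≡ just x ⊎ b ≡ just x
minM-sel nothing  b        eq   = inj₂ eq
minM-sel (just a) nothing  eq   = inj₁ eq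
minM-sel (just a) (just b) refl with ℤP.⊓-sel a b
... | inj₁ a⊓b≡a = inj₁ (cong just (sym a⊓b≡a))
... | inj₂ a⊓b≡b = inj₂ (cong just (sym a⊓b≡b))

finMinM-attained : ∀ n (g : Fin n → Maybe ℤ) {x} → finMinM n g ≡ just x → ∃ λ k → g k ≡ just x
finMinM-attained (suc n) g eq with minM-sel (g zero) (finMinM n (g ∘ suc)) eq
... | inj₁ g0≡x = zero , g0≡x
... | inj₂ min≡x = Prod.map suc (λ gk≡x → gk≡x) (finMinM-attained n (g ∘ suc) min≡x)

⊔-min0<0⇒just : ∀ K z → K ℤ.⊔ min0 z ℤ.< + 0 → ∃ λ x → z ≡ just x × x ℤ.≤ K ℤ.⊔ min0 z
⊔-min0<0⇒just K nothing  neg = ⊥-elim (ℤP.<⇒≱ neg (ℤP.i≤j⊔i K (+ 0)))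
⊔-min0<0⇒just K (just x) neg with x ℤP.≤? + 0
... | yes x≤0 rewrite ℤP.i≥j⇒i⊓j≡j x≤0 = x , refl , ℤP.i≤j⊔i K x
... | no  x≰0 rewrite ℤP.i≤j⇒i⊓j≡i (ℤP.<⇒≤ (ℤP.≰⇒> x≰0)) =
  ⊥-elim (ℤP.<⇒≱ neg (ℤP.i≤j⊔i K (+ 0)))

atFirstJust : ∀ {X Y : Set} n → (Fin n → Maybe X) → (Fin n → Y) → Y → Y
atFirstJust zero    g h d = d
atFirstJust (suc n) g h d with g zero
... | just _  = h zero
... | nothing = atFirstJust n (g ∘ suc) (h ∘ suc) d

atFirstJust-const : ∀ {X Y : Set} n (g : Fin n → Maybe X) (h : Fin n → Y) d {y} →
  (∀ k → Is-just (g k) → h k ≡ y) → ∀ {k} → Is-just (g k) → atFirstJust n g h d ≡ y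
atFirstJust-const (suc n) g h d h≡y {k} jk with g zero in g0≡
... | just _ = h≡y zero (≡just⇒Is-just g0≡)
atFirstJust-const (suc n) g h d h≡y {zero}  jk | nothing with () ← subst Is-just g0≡ jk
atFirstJust-const (suc n) g h d h≡y {suc k} jk          | nothing =
  atFirstJust-const n (g ∘ suc) (h ∘ suc) d (h≡y ∘ suc) jk

prefix-cong : ∀ {X Y : Set} {f f′ : ℕ → X} {g g′ : ℕ → Y} m →
  (∀ k → k < m → f k ≡ f′ k) → (∀ k → k < m → g k ≡ g′ k) → prefix f g m ≡ prefix f′ g′ m
prefix-cong zero    f≡ g≡ = refl
prefix-cong (suc m) f≡ g≡ =
  cong₂ (λ past x → past ++ [ x ])
    (prefix-cong m (λ k → f≡ k ∘ ℕP.m<n⇒m<1+n) (λ k → g≡ k ∘ ℕP.m<n⇒m<1+n))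
    (cong₂ _,_ (f≡ m ℕP.≤-refl) (g≡ m ℕP.≤-refl))

prefix-map₁ : ∀ {X X′ Y : Set} (h : X → X′) (f : ℕ → X) (g : ℕ → Y) m →
  map (Prod.map₁ h) (prefix f g m) ≡ prefix (h ∘ f) g m
prefix-map₁ h f g zero    = refl
prefix-map₁ h f g (suc m) =
  trans (ListP.map-++ (Prod.map₁ h) (prefix f g m) _)
        (cong (_++ [ (h (f m) , g m) ]) (prefix-map₁ h f g m))

module Paths (G : WGA) where
  open WGA G

  edgeW : (ℕ → Fin nQ) → (ℕ → Fin nA) → ℕ → ℤ
  edgeW P a m = w (P m) (a m) (P (suc m))

  segW-snoc : ∀ P a k j → segW G P a k (suc j) ≡ segW G P a k j ℤ.+ edgeW P a (k + j)
  segW-snoc P a k zero rewrite ℕP.+-identityʳ k =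
    trans (ℤP.+-identityʳ (edgeW P a k)) (sym (ℤP.+-identityˡ (edgeW P a k)))
  segW-snoc P a k (suc j) = begin
    edgeW P a k ℤ.+ segW G P a (suc k) (suc j)
      ≡⟨ cong (λ y → edgeW P a k ℤ.+ y) (segW-snoc P a (suc k) j) ⟩
    edgeW P a k ℤ.+ (segW G P a (suc k) j ℤ.+ edgeW P a (suc k + j))
      ≡⟨ sym (ℤP.+-assoc (edgeW P a k) _ _) ⟩
    segW G P a k (suc j) ℤ.+ edgeW P a (suc k + j)
      ≡⟨ cong (λ m → segW G P a k (suc j) ℤ.+ edgeW P a m) (sym (ℕP.+-suc k j)) ⟩
    segW G P a k (suc j) ℤ.+ edgeW P a (k + suc j) ∎
    where open ≡-Reasoning

  segW-cong : ∀ {P P′ a a′ n} → (∀ m → m ≤ n → P m ≡ P′ m) → (∀ m → m < n → a m ≡ a′ m) →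
              ∀ k j → k + j ≤ n → segW G P a k j ≡ segW G P′ a′ k j
  segW-cong                                 P≡ a≡ k zero    _        = refl
  segW-cong {P} {P′} {a} {a′} {n} P≡ a≡ k (suc j) k+1+j≤n =
    cong₂ ℤ._+_ edge≡ (segW-cong P≡ a≡ (suc k) j 1+k+j≤n)
    where
    1+k+j≤n : suc k + j ≤ n
    1+k+j≤n = subst (_≤ n) (ℕP.+-suc k j) k+1+j≤n
    k<n : k < n
    k<n = ℕP.m+n≤o⇒m≤o (suc k) 1+k+j≤n
    edge≡ : edgeW P a k ≡ edgeW P′ a′ k
    edge≡ = trans (cong₂ (λ p σ → w p σ (P (suc k))) (P≡ k (ℕP.<⇒≤ k<n)) (a≡ k k<n))
                  (cong (w (P′ k) (a′ k)) (P≡ (suc k) k<n))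

  extend : (ℕ → Fin nQ) → ℕ → Fin nQ → ℕ → Fin nQ
  extend P n q m with m ≤? n
  ... | yes _ = P m
  ... | no  _ = q

  extend-≤ : ∀ P {n} q {m} → m ≤ n → extend P n q m ≡ P m
  extend-≤ P {n} q {m} m≤n with m ≤? n
  ... | yes _   = refl
  ... | no  m≰n = contradiction m≤n m≰n

  extend-suc : ∀ P n q → extend P n q (suc n) ≡ q
  extend-suc P n q with suc n ≤? n
  ... | yes n<n = contradiction n<n (ℕP.<-irrefl refl)
  ... | no  _   = refl

  segW-extend : ∀ P {n} q a {k j} → k + j ≤ n → segW G (extend P n q) a k j ≡ segW G P a k j
  segW-extend P q a {k} {j} = segW-cong (λ _ → extend-≤ P q) (λ _ _ → refl) k j

  module _ (A : ℕ → Fin nA) where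

    edgeW-extend : ∀ P {n p} q → P n ≡ p → edgeW (extend P n q) A n ≡ w p (A n) q
    edgeW-extend P {n} q Pn≡p =
      cong₂ (λ p′ q′ → w p′ (A n) q′) (trans (extend-≤ P q ℕP.≤-refl) Pn≡p) (extend-suc P n q)

    record NegWindow (P : ℕ → Fin nQ) (n k : ℕ) (x : ℤ) : Set where
      field
        start   : ℕ
        fits    : start + suc k ≡ n
        short<0 : ∀ t → t < k → segW G P A start (suc t) ℤ.< + 0
        total≤  : segW G P A start (suc k) ℤ.≤ x

      ¬GW : x ℤ.< + 0 → ¬ GW G P A start (suc k)
      ¬GW x<0 (zero , () , _)
      ¬GW x<0 (suc t , _ , t<1+k , 0≤segW) with ℕP.m<1+n⇒m<n∨m≡n t<1+k
      ... | inj₁ t<k  = ℤP.<⇒≱ (short<0 t t<k) 0≤segW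
      ... | inj₂ refl = ℤP.<⇒≱ (ℤP.≤-<-trans total≤ x<0) 0≤segW

    NegWindow-weaken : ∀ {P n k x y} → x ℤ.≤ y → NegWindow P n k x → NegWindow P n k y
    NegWindow-weaken x≤y W = record
      { start = start ; fits = fits ; short<0 = short<0 ; total≤ = ℤP.≤-trans total≤ x≤y }
      where open NegWindow W

    window-start : ∀ P {n p} q → P n ≡ p → NegWindow (extend P n q) (suc n) 0 (w p (A n) q)
    window-start P {n} q Pn≡p = record
      { start   = n
      ; fits    = ℕP.+-comm n 1
      ; short<0 = λ _ ()
      ; total≤  = ℤP.≤-reflexive (trans (ℤP.+-identityʳ _) (edgeW-extend P q Pn≡p))
      }

    window-extend : ∀ P {n p k x} q → P n ≡ p → NegWindow P n k x → x ℤ.< + 0 →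
                    NegWindow (extend P n q) (suc n) (suc k) (x ℤ.+ w p (A n) q)
    window-extend P {n} {p} {k} {x} q Pn≡p W x<0 = record
      { start   = start
      ; fits    = trans (ℕP.+-suc start (suc k)) (cong suc fits)
      ; short<0 = short<0′
      ; total≤  = total≤′
      }
      where
      open NegWindow W
      P′ = extend P n q

      unchanged : ∀ {t} → t ≤ k → segW G P′ A start (suc t) ≡ segW G P A start (suc t)
      unchanged {t} t≤k =
        segW-extend P q A {start} {suc t} (subst (_ ≤_) fits (ℕP.+-monoʳ-≤ start (s≤s t≤k)))

      short<0′ : ∀ t → t < suc k → segW G P′ A start (suc t) ℤ.< + 0
      short<0′ t t<1+k with ℕP.m<1+n⇒m<n∨m≡n t<1+k
      ... | inj₁ t<k  = subst (ℤ._< + 0) (sym (unchanged (ℕP.<⇒≤ t<k))) (short<0 t t<k)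
      ... | inj₂ refl = subst (ℤ._< + 0) (sym (unchanged ℕP.≤-refl)) (ℤP.≤-<-trans total≤ x<0)

      total≤′ : segW G P′ A start (suc (suc k)) ℤ.≤ x ℤ.+ w p (A n) q
      total≤′ = begin
        segW G P′ A start (suc (suc k))
          ≡⟨ segW-snoc P′ A start (suc k) ⟩
        segW G P′ A start (suc k) ℤ.+ edgeW P′ A (start + suc k)
          ≡⟨ cong₂ ℤ._+_ (unchanged ℕP.≤-refl) (trans (cong (edgeW P′ A) fits) (edgeW-extend P q Pn≡p)) ⟩
        segW G P A start (suc k) ℤ.+ w p (A n) q
          ≤⟨ ℤP.+-monoˡ-≤ (w p (A n) q) total≤ ⟩
        x ℤ.+ w p (A n) q ∎
        where open ℤP.≤-Reasoning hiding (start)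

  module _ (O : ℕ → Fin nO) (A : ℕ → Fin nA) where

    record Reaches (n : ℕ) (q : Fin nQ) (P : ℕ → Fin nQ) : Set where
      field
        starts   : P 0 ≡ qI
        ends     : P n ≡ q
        observed : ∀ m → m < n → obs (P m) ≡ O m
        steps    : ∀ m → m < n → Δ (P m) (A m) (P (suc m)) ≡ true

    reaches-extend : ∀ {n p q P} → Reaches n p P → obs p ≡ O n → Δ p (A n) q ≡ true →
                     Reaches (suc n) q (extend P n q)
    reaches-extend {n} {p} {q} {P} r op≡ Δpq = record
      { starts   = trans (extend-≤ P {n} q z≤n) starts
      ; ends     = extend-suc P n q
      ; observed = observed′
      ; steps    = steps′
      }
      where
      open Reaches r
      P′ = extend P n q
      P′n≡p = trans (extend-≤ P q ℕP.≤-refl) ends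

      observed′ : ∀ m → m < suc n → obs (P′ m) ≡ O m
      observed′ m m<1+n with ℕP.m<1+n⇒m<n∨m≡n m<1+n
      ... | inj₁ m<n  = trans (cong obs (extend-≤ P q (ℕP.<⇒≤ m<n))) (observed m m<n)
      ... | inj₂ refl = trans (cong obs P′n≡p) op≡

      steps′ : ∀ m → m < suc n → Δ (P′ m) (A m) (P′ (suc m)) ≡ true
      steps′ m m<1+n with ℕP.m<1+n⇒m<n∨m≡n m<1+n
      ... | inj₁ m<n  = subst₂ (λ x y → Δ x (A m) y ≡ true)
                          (sym (extend-≤ P q (ℕP.<⇒≤ m<n))) (sym (extend-≤ P q m<n)) (steps m m<n)
      ... | inj₂ refl = subst₂ (λ x y → Δ x (A m) y ≡ true) (sym P′n≡p) (sym (extend-suc P n q)) Δpq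

  WinsDirFix : ObsStrategy G → ℕ → Set
  WinsDirFix s ℓ = ∀ o a → IsPlay G o a → ConsistentObs G s o a → DirFix G ℓ o a

  record ConsistentHistory (s : ObsStrategy G) (i : ℕ) (P : ℕ → Fin nQ) (A : ℕ → Fin nA) : Set where
    field
      starts  : P 0 ≡ qI
      steps   : ∀ m → m < i → Δ (P m) (A m) (P (suc m)) ≡ true
      follows : ∀ m → m < i → A m ≡ s (prefix (obs ∘ P) A m) (obs (P m))

  -- After the history, Eve follows s and Adam resolves nondeterminism arbitrarily.
  module Completion {s i P A} (h : ConsistentHistory s i P A) where
    open ConsistentHistory h

    choose : ℕ → List (Fin nO × Fin nA) → Fin nQ → Fin nA
    choose m past x with m <? i
    ... | yes _ = A m
    ... | no  _ = s past (obs x)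

    successor : ℕ → Fin nQ → Fin nA → Fin nQ
    successor m x σ with m <? i
    ... | yes _ = P (suc m)
    ... | no  _ = proj₁ (Δ-total x σ)

    mutual
      run : ℕ → List (Fin nO × Fin nA) × Fin nQ
      run zero    = [] , P 0
      run (suc m) = past m ++ [ (obs (state m) , action m) ] , successor m (state m) (action m)

      past : ℕ → List (Fin nO × Fin nA)
      past m = proj₁ (run m)

      state : ℕ → Fin nQ
      state m = proj₂ (run m)

      action : ℕ → Fin nA
      action m = choose m (past m) (state m)

    prefix≡past : ∀ m → prefix (obs ∘ state) action m ≡ past m
    prefix≡past zero    = refl
    prefix≡past (suc m) = cong (_++ [ (obs (state m) , action m) ]) (prefix≡past m)

    state-≤ : ∀ {m} → m ≤ i → state m ≡ P m
    state-≤ {zero}  _   = refl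
    state-≤ {suc m} m<i with m <? i
    ... | yes _   = refl
    ... | no  m≮i = contradiction m<i m≮i

    action-< : ∀ {m} → m < i → action m ≡ A m
    action-< {m} m<i with m <? i
    ... | yes _   = refl
    ... | no  m≮i = contradiction m<i m≮i

    inGamma : InGamma G (obs ∘ state) action state
    inGamma m = refl , step
      where
      step : Δ (state m) (action m) (state (suc m)) ≡ true
      step with m <? i
      ... | yes m<i = subst (λ x → Δ x (A m) (P (suc m)) ≡ true)
                        (sym (state-≤ (ℕP.<⇒≤ m<i))) (steps m m<i)
      ... | no  _   = proj₂ (Δ-total _ _)

    isPlay : IsPlay G (obs ∘ state) action
    isPlay = cong obs starts , state , inGamma

    consistent : ConsistentObs G s (obs ∘ state) action
    consistent m with m <? i
    ... | no  _   = cong (λ past′ → s past′ (obs (state m))) (sym (prefix≡past m))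
    ... | yes m<i = trans (follows m m<i)
      (cong₂ s (prefix-cong m (λ k k<m → cong obs (sym (state-≤ (ℕP.<⇒≤ (ℕP.<-trans k<m m<i)))))
                              (λ k k<m → sym (action-< (ℕP.<-trans k<m m<i))))
               (cong obs (sym (state-≤ (ℕP.<⇒≤ m<i)))))

    GW-within-history : ∀ {st ℓ} → st + ℓ ≤ i → GW G state action st ℓ → GW G P A st ℓ
    GW-within-history {st} st+ℓ≤i (j , 1≤j , j≤ℓ , 0≤segW) =
      j , 1≤j , j≤ℓ , subst (+ 0 ℤ.≤_) segW≡ 0≤segW
      where
      segW≡ : segW G state action st j ≡ segW G P A st j
      segW≡ = segW-cong (λ _ → state-≤) (λ _ → action-<) st j
                (ℕP.≤-trans (ℕP.+-monoʳ-≤ st j≤ℓ) st+ℓ≤i)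

  history-GW : ∀ {s ℓ i P A} → WinsDirFix s ℓ → ConsistentHistory s i P A →
               ∀ st → st + ℓ ≤ i → GW G P A st ℓ
  history-GW win h st st+ℓ≤i =
    GW-within-history st+ℓ≤i (win (obs ∘ state) action isPlay consistent state inGamma st)
    where open Completion h

  module _ (L : ℕ) where

    fI-just : ∀ {q v} → fI G L q ≡ just v → q ≡ qI × (∀ j → v j ≡ + 0)
    fI-just {q} eq with q Fin.≟ qI
    fI-just refl | yes q≡qI = q≡qI , λ _ → refl
    fI-just ()   | no  _

    ζ-zero-attained : ∀ f σ q {x} → ζ G L f σ q zero ≡ just x →
                      ∃ λ p → Is-just (f p) × Δ p σ q ≡ true × w p σ q ≡ x
    ζ-zero-attained f σ q eq with finMinM-attained nQ _ eq
    ... | p , step≡x with f p in fp≡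
    ... | nothing with () ← step≡x
    ... | just _ with Δ p σ q in Δpq
    ...   | false with () ← step≡x
    ...   | true with refl ← step≡x = p , ≡just⇒Is-just fp≡ , Δpq , refl

    ζ-suc-attained : ∀ f σ q i {x} → ζ G L f σ q (suc i) ≡ just x →
                     ∃ λ p → ∃ λ u → f p ≡ just u × Δ p σ q ≡ true × u (inject₁ i) ℤ.< + 0
                                     × u (inject₁ i) ℤ.+ w p σ q ≡ x
    ζ-suc-attained f σ q i eq with finMinM-attained nQ _ eq
    ... | p , step≡x with f p in fp≡
    ... | nothing with () ← step≡x
    ... | just u with Δ p σ q in Δpq
    ...   | false with () ← step≡x
    ...   | true with u (inject₁ i) ℤ.<? + 0
    ...     | yes u<0 with refl ← step≡x = p , u , fp≡ , Δpq , u<0 , refl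
    ...     | no  _   with () ← step≡x

module Simulation (G : WGA) (L : ℕ) (s : ObsStrategy G) where
  open WGA G
  open Paths G

  -- The default obs qI is only ever read off positions with empty support.
  observationOf : Pos G L → Fin nO
  observationOf f = atFirstJust nQ f obs (obs qI)

  strategy : PIStrategy G L
  strategy past f = s (map (Prod.map₁ observationOf) past) (observationOf f)

  module _ {F A} (cons : ConsistentPI G L strategy F A) where

    O : ℕ → Fin nO
    O n = observationOf (F n)

    successorOf : ∀ n → IsSucc G L (F n) (A n) (F (suc n))
    successorOf n = proj₂ (proj₂ cons n)

    predecessor : ∀ n {q} → Is-just (F (suc n) q) → InPost G L (F n) (A n) q
    predecessor n jq = proj₁ (proj₁ (proj₂ (proj₂ (successorOf n))) _ jq)

    clamped : ∀ n {q v} → F (suc n) q ≡ just v → ∀ j → v j ≡ clamp G L (ζ G L (F n) (A n) q j)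
    clamped n = proj₂ (proj₂ (proj₂ (proj₂ (successorOf n)))) _ _

    F0-just : ∀ {q v} → F 0 q ≡ just v → q ≡ qI × (∀ j → v j ≡ + 0)
    F0-just F0q≡v = fI-just L (trans (cong (λ f → f _) (sym (proj₁ cons))) F0q≡v)

    supportObs : ℕ → Fin nO
    supportObs zero    = obs qI
    supportObs (suc n) = proj₁ (successorOf n)

    support-in-block : ∀ n q → Is-just (F n q) → obs q ≡ supportObs n
    support-in-block zero    q jq = cong obs (proj₁ (F0-just (proj₂ (Is-just⇒≡just jq))))
    support-in-block (suc n) q jq = proj₂ (proj₁ (proj₂ (proj₂ (successorOf n))) q jq)

    support-observed : ∀ n {q} → Is-just (F n q) → obs q ≡ O n
    support-observed n jq = trans (support-in-block n _ jq)
      (sym (atFirstJust-const nQ (F n) obs (obs qI) (support-in-block n) jq))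

    Witnessed : ℕ → Fin nQ → ℕ → ℤ → Set
    Witnessed n q k x = ∃ λ P → Reaches O A n q P × NegWindow A P n k x

    Invariant : ℕ → Set
    Invariant n = ∀ q v → F n q ≡ just v →
      ∃ (Reaches O A n q) × (∀ j → v j ℤ.< + 0 → Witnessed n q (toℕ j) (v j))

    reachable : ∀ {n p} → Invariant n → Is-just (F n p) → ∃ (Reaches O A n p)
    reachable IH jp = proj₁ (IH _ _ (proj₂ (Is-just⇒≡just jp)))

    witness-step : ∀ {n q} → Invariant n → ∀ j {x} → ζ G L (F n) (A n) q j ≡ just x →
                   Witnessed (suc n) q (toℕ j) x
    witness-step {n} {q} IH zero ζ≡x with ζ-zero-attained L (F n) (A n) q ζ≡x
    ... | p , jp , Δpq , w≡x with reachable IH jp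
    ... | P , r = extend P n q , reaches-extend O A r (support-observed n jp) Δpq
                , subst (NegWindow A _ (suc n) 0) w≡x (window-start A P q (Reaches.ends r))
    witness-step {n} {q} IH (suc j) ζ≡x with ζ-suc-attained L (F n) (A n) q j ζ≡x
    ... | p , u , Fp≡u , Δpq , u<0 , sum≡x with proj₂ (IH p u Fp≡u) (inject₁ j) u<0
    ... | P , r , W = extend P n q , reaches-extend O A r (support-observed n (≡just⇒Is-just Fp≡u)) Δpq
                    , subst₂ (NegWindow A _ (suc n)) (cong suc (FinP.toℕ-inject₁ j)) sum≡x
                        (window-extend A P q (Reaches.ends r) W u<0)

    invariant : ∀ n → Invariant n
    invariant zero q v F0q≡v with F0-just F0q≡v
    ... | refl , v≡0 = ((λ _ → qI) , record { starts = refl ; ends = refl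
                                            ; observed = λ _ () ; steps = λ _ () })
                     , λ j v<0 → contradiction (subst (ℤ._< + 0) (v≡0 j) v<0) (ℤP.<-irrefl refl)
    invariant (suc n) q v Fq≡v = reach , witness
      where
      IH = invariant n
      reach : ∃ (Reaches O A (suc n) q)
      reach with predecessor n (≡just⇒Is-just Fq≡v)
      ... | p , jp , Δpq with reachable IH jp
      ... | P , r = extend P n q , reaches-extend O A r (support-observed n jp) Δpq

      witness : ∀ j → v j ℤ.< + 0 → Witnessed (suc n) q (toℕ j) (v j)
      witness j vj<0 with ⊔-min0<0⇒just _ _ (subst (ℤ._< + 0) (clamped n Fq≡v j) vj<0)
      ... | x , ζ≡x , x≤ = Prod.map₂ (Prod.map₂ (NegWindow-weaken A x≤vj)) (witness-step IH j ζ≡x)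
        where
        x≤vj : x ℤ.≤ v j
        x≤vj = subst (x ℤ.≤_) (sym (clamped n Fq≡v j)) x≤

    consistent-history : ∀ {i q P} → Reaches O A i q P → ConsistentHistory s i P A
    consistent-history {i} {q} {P} r = record { starts = starts ; steps = steps ; follows = follows }
      where
      open Reaches r
      follows : ∀ m → m < i → A m ≡ s (prefix (obs ∘ P) A m) (obs (P m))
      follows m m<i = trans (proj₁ (proj₂ cons m))
        (cong₂ s (trans (prefix-map₁ observationOf F A m)
                        (prefix-cong m (λ k k<m → sym (observed k (ℕP.<-trans k<m m<i))) (λ _ _ → refl)))
                 (sym (observed m m<i)))

    never-bad : WinsDirFix s (suc L) → ∀ i → ¬ BadPos G L (F i)
    never-bad win i (q , v , Fq≡v , v<0) with proj₂ (invariant i q v Fq≡v) (fromℕ L) v<0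
    ... | P , r , W = NegWindow.¬GW W′ v<0
                        (history-GW win (consistent-history r) start (ℕP.≤-reflexive fits))
      where
      W′ = subst (λ k → NegWindow A P i k (v (fromℕ L))) (FinP.toℕ-fromℕ L) W
      open NegWindow W′

lemma6 : (G : WGA) (L : ℕ) → EveWinsDirFix G (suc L) → EveWinsSafety G L
lemma6 G L (s , win) = strategy , λ F A cons → never-bad cons win
  where open Simulation G L s
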